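{- Let $m=2k+1$ with $k\ge 1$ an integer. Then the number of palindromic binary words $x\in\{0,1\}^m$ (i.e. words equal to their reversal) with $Z(x)\in\{1,-1\}$, i.e. the number of palindromes in $V({\cal B}^{*(1)}_m)$, equals $$\binom{(m+1)/2}{\lfloor (m+1)/4\rfloor}.$$
   Context: For a binary word $x$ of length $m$, $Z(x)$ denotes the number of 0's at odd positions of $x$ minus the number of 0's at even positions of $x$. The component ${\cal B}^{*(1)}_m$ of the 2-factor transfer digraph ${\cal D}^*_m$ has as vertex set exactly the binary words $x$ of length $m$ with $Z(x)\in\{1,-1\}$. -}

module Defs where

open import Data.Bool using (Bool; true; false)
open import Data.Nat using (ℕ; zero; suc)
open import Data.Integer using (ℤ; +_; -_; _-_; _+_)
open import Data.Vec using (Vec; []; _∷_; reverse)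
open import Data.List using (List; []; _∷_; map; _++_; filter; length)
open import Relation.Binary.PropositionalEquality using (_≡_)
open import Data.Sum using (_⊎_)

-- Binary words of length m: Vec Bool m, with false = 0 and true = 1.
-- Positions are numbered 1,2,…,m from the left.

allWords : (m : ℕ) → List (Vec Bool m)
allWords zero = [] ∷ []
allWords (suc m) = map (false ∷_) (allWords m) ++ map (true ∷_) (allWords m)

zeroInd : Bool → ℤ
zeroInd false = + 1
zeroInd true  = + 0

-- Zodd x  = (#0's at odd positions) − (#0's at even positions),
-- for a word whose first letter is at an odd position.
-- Zeven x = the same when the first letter is at an even position.
mutual
  Zodd : ∀ {m} → Vec Bool m → ℤ
  Zodd [] = + 0
  Zodd (b ∷ x) = zeroInd b + Zeven x

  Zeven : ∀ {m} → Vec Bool m → ℤ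
  Zeven [] = + 0
  Zeven (b ∷ x) = - zeroInd b + Zodd x

Z : ∀ {m} → Vec Bool m → ℤ
Z = Zodd

IsPalindrome : ∀ {m} → Vec Bool m → Set
IsPalindrome x = x ≡ reverse x

InB1 : ∀ {m} → Vec Bool m → Set
InB1 x = (Z x ≡ + 1) ⊎ (Z x ≡ - (+ 1))

module Submission where

-- Removing the two equal end letters of an odd palindrome a y a leaves an odd palindrome y,
-- and Z(a y a) = 2[a = 0] − Z(y).  So the number N_j(t) of palindromes of length 2j+1 with
-- Z = t satisfies N_{j+1}(t) = N_j(2 − t) + N_j(−t).  Pascal's rule together with the symmetry
-- of binomial coefficients then gives N_j(1 + 2u) = C(j, ⌈j/2⌉ + u) for every integer u, and
-- N_j(1) + N_j(−1) = C(j, ⌈j/2⌉) + C(j, ⌈j/2⌉ − 1) = C(j+1, ⌈j/2⌉).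

open import Defs
open import Data.Bool using (Bool; true; false)
import Data.Bool.Properties as Boolₚ
open import Data.Empty using (⊥-elim)
import Data.Integer as ℤ
open ℤ using (ℤ; +_; -[1+_]; -_; 1ℤ; -1ℤ)
import Data.Integer.Properties as ℤₚ
open import Data.Integer.Tactic.RingSolver using (solve-∀)
open import Data.List using (List; []; _∷_; length; filter; map; _++_)
import Data.List.Properties as Listₚ
open import Data.List.Relation.Unary.All using (universal)
open import Data.Nat using (ℕ; zero; suc; _+_; _*_; _/_; _≥_; _<_; _≤?_; ⌊_/2⌋; ⌈_/2⌉; s≤s; z≤n)
open import Data.Nat.Combinatorics using (_C_; nCk≡nC[n∸k]; k>n⇒nCk≡0; nCk+nC[k+1]≡[n+1]C[k+1])
open import Data.Nat.DivMod using (m/n≡1+[m∸n]/n; m*n/n≡m; m*n/m*o≡n/o)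
import Data.Nat.Properties as ℕₚ
open import Algebra.Properties.CommutativeSemigroup ℕₚ.+-commutativeSemigroup using (interchange)
import Data.Nat.Tactic.RingSolver as ℕSolver
open import Data.Product using (_×_; _,_; proj₁; proj₂; map₂)
open import Data.Sum using (inj₁; inj₂)
open import Data.Vec using (Vec; []; _∷_; _∷ʳ_; reverse)
import Data.Vec.Properties as Vecₚ
open import Function using (_∘_)
open import Level using (Level; 0ℓ)
open import Relation.Nullary using (yes; no; does; ¬_)
open import Relation.Nullary.Decidable using (_×-dec_)
open import Relation.Unary using (Pred; Decidable; _≐_; _∪_)
open import Relation.Unary.Properties using (_∪?_)
open import Relation.Binary.PropositionalEquality
  using (_≡_; _≢_; refl; sym; trans; cong; cong₂; module ≡-Reasoning)

private
  variable
    ℓ₁ ℓ₂ ℓ ℓ′ : Level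
    A : Set ℓ₁
    B : Set ℓ₂
    n : ℕ

count : {P : Pred A ℓ} → Decidable P → List A → ℕ
count P? xs = length (filter P? xs)

module _ {P : Pred A ℓ} (P? : Decidable P) where

  count-++ : ∀ xs ys → count P? (xs ++ ys) ≡ count P? xs + count P? ys
  count-++ xs ys = trans (cong length (Listₚ.filter-++ P? xs ys)) (Listₚ.length-++ (filter P? xs))

  count-map : ∀ (f : B → A) xs → count P? (map f xs) ≡ count (P? ∘ f) xs
  count-map f [] = refl
  count-map f (x ∷ xs) with does (P? (f x))
  ... | true  = cong suc (count-map f xs)
  ... | false = count-map f xs

  count-none : (∀ x → ¬ P x) → ∀ xs → count P? xs ≡ 0
  count-none ¬P xs = cong length (Listₚ.filter-none P? (universal ¬P xs))

  count-≐ : {Q : Pred A ℓ′} (Q? : Decidable Q) → P ≐ Q → ∀ xs → count P? xs ≡ count Q? xs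
  count-≐ Q? P≐Q xs = cong length (Listₚ.filter-≐ P? Q? P≐Q xs)

  count-∪ : {Q : Pred A ℓ′} (Q? : Decidable Q) → (∀ x → P x → ¬ Q x) →
            ∀ xs → count (P? ∪? Q?) xs ≡ count P? xs + count Q? xs
  count-∪ Q? disjoint [] = refl
  count-∪ Q? disjoint (x ∷ xs) with P? x | Q? x
  ... | yes px | yes qx = ⊥-elim (disjoint x px qx)
  ... | yes _  | no _   = cong suc (count-∪ Q? disjoint xs)
  ... | no _   | yes _  = trans (cong suc (count-∪ Q? disjoint xs)) (sym (ℕₚ.+-suc _ _))
  ... | no _   | no _   = count-∪ Q? disjoint xs

count-allWords-∷ : ∀ n {P : Pred (Vec Bool (suc n)) ℓ} (P? : Decidable P) →
  count P? (allWords (suc n)) ≡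
    count (P? ∘ (false ∷_)) (allWords n) + count (P? ∘ (true ∷_)) (allWords n)
count-allWords-∷ n P? = begin
  count P? (map (false ∷_) (allWords n) ++ map (true ∷_) (allWords n))
    ≡⟨ count-++ P? (map (false ∷_) (allWords n)) _ ⟩
  count P? (map (false ∷_) (allWords n)) + count P? (map (true ∷_) (allWords n))
    ≡⟨ cong₂ _+_ (count-map P? (false ∷_) (allWords n)) (count-map P? (true ∷_) (allWords n)) ⟩
  count (P? ∘ (false ∷_)) (allWords n) + count (P? ∘ (true ∷_)) (allWords n) ∎
  where open ≡-Reasoning

countWithEnds : ∀ n {P : Pred (Vec Bool (suc (suc n))) ℓ} → Decidable P → Bool → Bool → ℕ
countWithEnds n P? a b = count (λ y → P? (a ∷ (y ∷ʳ b))) (allWords n)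

count-allWords-∷ʳ : ∀ n {P : Pred (Vec Bool (suc n)) ℓ} (P? : Decidable P) →
  count P? (allWords (suc n)) ≡
    count (P? ∘ (_∷ʳ false)) (allWords n) + count (P? ∘ (_∷ʳ true)) (allWords n)
count-allWords-∷ʳ zero {P} P? = trans (count-allWords-∷ 0 P?)
  (cong₂ _+_ (count-≐ (P? ∘ (false ∷_)) (P? ∘ (_∷ʳ false)) ∷≐∷ʳ (allWords 0))
              (count-≐ (P? ∘ (true ∷_)) (P? ∘ (_∷ʳ true)) ∷≐∷ʳ (allWords 0)))
  where
    ∷≐∷ʳ : ∀ {b} → (λ y → P (b ∷ y)) ≐ (λ y → P (y ∷ʳ b))
    ∷≐∷ʳ = (λ { {[]} p → p }) , (λ { {[]} p → p })
count-allWords-∷ʳ (suc n) P? = begin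
  count P? (allWords (suc (suc n)))
    ≡⟨ count-allWords-∷ (suc n) P? ⟩
  count (P? ∘ (false ∷_)) (allWords (suc n)) + count (P? ∘ (true ∷_)) (allWords (suc n))
    ≡⟨ cong₂ _+_ (count-allWords-∷ʳ n (P? ∘ (false ∷_))) (count-allWords-∷ʳ n (P? ∘ (true ∷_))) ⟩
  (ends false false + ends false true) + (ends true false + ends true true)
    ≡⟨ interchange (ends false false) (ends false true) (ends true false) (ends true true) ⟩
  (ends false false + ends true false) + (ends false true + ends true true)
    ≡⟨ cong₂ _+_ (count-allWords-∷ n (P? ∘ (_∷ʳ false))) (count-allWords-∷ n (P? ∘ (_∷ʳ true))) ⟨
  count (P? ∘ (_∷ʳ false)) (allWords (suc n)) + count (P? ∘ (_∷ʳ true)) (allWords (suc n)) ∎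
  where
    open ≡-Reasoning
    ends = countWithEnds n P?

count-allWords-ends : ∀ n {P : Pred (Vec Bool (suc (suc n))) ℓ} (P? : Decidable P) →
  count P? (allWords (suc (suc n))) ≡
    (countWithEnds n P? false false + countWithEnds n P? false true) +
    (countWithEnds n P? true false + countWithEnds n P? true true)
count-allWords-ends n P? = trans (count-allWords-∷ (suc n) P?)
  (cong₂ _+_ (count-allWords-∷ʳ n (P? ∘ (false ∷_))) (count-allWords-∷ʳ n (P? ∘ (true ∷_))))

reverse-∷ʳ : ∀ (y : Vec A n) b → reverse (y ∷ʳ b) ≡ b ∷ reverse y
reverse-∷ʳ y b = begin
  reverse (y ∷ʳ b)                     ≡⟨ cong (λ z → reverse (z ∷ʳ b)) (Vecₚ.reverse-involutive y) ⟨
  reverse (reverse (reverse y) ∷ʳ b)   ≡⟨ cong reverse (Vecₚ.reverse-∷ b (reverse y)) ⟨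
  reverse (reverse (b ∷ reverse y))    ≡⟨ Vecₚ.reverse-involutive (b ∷ reverse y) ⟩
  b ∷ reverse y                        ∎
  where open ≡-Reasoning

reverse-∷-∷ʳ : ∀ a (y : Vec A n) b → reverse (a ∷ (y ∷ʳ b)) ≡ b ∷ (reverse y ∷ʳ a)
reverse-∷-∷ʳ a y b = trans (Vecₚ.reverse-∷ a (y ∷ʳ b)) (cong (_∷ʳ a) (reverse-∷ʳ y b))

palindrome-ends : ∀ a (y : Vec Bool n) b → IsPalindrome (a ∷ (y ∷ʳ b)) → a ≡ b × IsPalindrome y
palindrome-ends a y b pal =
  map₂ (Vecₚ.∷ʳ-injectiveˡ y (reverse y)) (Vecₚ.∷-injective (trans pal (reverse-∷-∷ʳ a y b)))

palindrome-extend : ∀ a (y : Vec Bool n) → IsPalindrome y → IsPalindrome (a ∷ (y ∷ʳ a))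
palindrome-extend a y pal = trans (cong (λ z → a ∷ (z ∷ʳ a)) pal) (sym (reverse-∷-∷ʳ a y a))

palindrome? : Decidable (IsPalindrome {n})
palindrome? x = Vecₚ.≡-dec Boolₚ._≟_ x (reverse x)

-- Recursive rather than 2 * j + 1, so that 2* suc j +1 reduces to suc (suc (2* j +1)).
2*_+1 : ℕ → ℕ
2* zero  +1 = 1
2* suc j +1 = suc (suc (2* j +1))

Zeven≡-Z : ∀ (x : Vec Bool n) → Zeven x ≡ - Z x
Zeven≡-Z []      = refl
Zeven≡-Z (b ∷ x) = begin
  - zeroInd b ℤ.+ Zodd x          ≡⟨ cong (λ z → - zeroInd b ℤ.+ z) (ℤₚ.neg-involutive (Zodd x)) ⟨
  - zeroInd b ℤ.+ - - Zodd x      ≡⟨ ℤₚ.neg-distrib-+ (zeroInd b) (- Zodd x) ⟨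
  - (zeroInd b ℤ.+ - Zodd x)      ≡⟨ cong (λ z → - (zeroInd b ℤ.+ z)) (Zeven≡-Z x) ⟨
  - Z (b ∷ x)                     ∎
  where open ≡-Reasoning

Z-∷ : ∀ b (x : Vec Bool n) → Z (b ∷ x) ≡ zeroInd b ℤ.- Z x
Z-∷ b x = cong (λ z → zeroInd b ℤ.+ z) (Zeven≡-Z x)

Z-∷ʳ : ∀ j (y : Vec Bool (2* j +1)) b → Z (y ∷ʳ b) ≡ Z y ℤ.- zeroInd b
Z-∷ʳ zero (c ∷ []) b = u+[-v+0]≡[u+0]-v (zeroInd c) (zeroInd b)
  where
    u+[-v+0]≡[u+0]-v : ∀ u v → u ℤ.+ (- v ℤ.+ + 0) ≡ (u ℤ.+ + 0) ℤ.- v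
    u+[-v+0]≡[u+0]-v = solve-∀
Z-∷ʳ (suc j) (c ∷ d ∷ y) b = begin
  Z (c ∷ d ∷ (y ∷ʳ b))
    ≡⟨⟩
  zeroInd c ℤ.+ (- zeroInd d ℤ.+ Z (y ∷ʳ b))
    ≡⟨ cong (λ z → zeroInd c ℤ.+ (- zeroInd d ℤ.+ z)) (Z-∷ʳ j y b) ⟩
  zeroInd c ℤ.+ (- zeroInd d ℤ.+ (Z y ℤ.- zeroInd b))
    ≡⟨ u+[v+[w-z]]≡[u+[v+w]]-z (zeroInd c) (- zeroInd d) (Z y) (zeroInd b) ⟩
  zeroInd c ℤ.+ (- zeroInd d ℤ.+ Z y) ℤ.- zeroInd b
    ≡⟨⟩
  Z (c ∷ d ∷ y) ℤ.- zeroInd b ∎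
  where
    open ≡-Reasoning
    u+[v+[w-z]]≡[u+[v+w]]-z : ∀ u v w z → u ℤ.+ (v ℤ.+ (w ℤ.- z)) ≡ u ℤ.+ (v ℤ.+ w) ℤ.- z
    u+[v+[w-z]]≡[u+[v+w]]-z = solve-∀

Z-∷-∷ʳ : ∀ j a (y : Vec Bool (2* j +1)) → Z (a ∷ (y ∷ʳ a)) ≡ zeroInd a ℤ.+ zeroInd a ℤ.- Z y
Z-∷-∷ʳ j a y = begin
  Z (a ∷ (y ∷ʳ a))                    ≡⟨ Z-∷ a (y ∷ʳ a) ⟩
  zeroInd a ℤ.- Z (y ∷ʳ a)            ≡⟨ cong (λ z → zeroInd a ℤ.- z) (Z-∷ʳ j y a) ⟩
  zeroInd a ℤ.- (Z y ℤ.- zeroInd a)   ≡⟨ u-[w-u]≡u+u-w (zeroInd a) (Z y) ⟩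
  zeroInd a ℤ.+ zeroInd a ℤ.- Z y     ∎
  where
    open ≡-Reasoning
    u-[w-u]≡u+u-w : ∀ u w → u ℤ.- (w ℤ.- u) ≡ u ℤ.+ u ℤ.- w
    u-[w-u]≡u+u-w = solve-∀

PalindromeWithZ : ℤ → Pred (Vec Bool n) 0ℓ
PalindromeWithZ t x = IsPalindrome x × Z x ≡ t

palindromeWithZ? : ∀ t → Decidable (PalindromeWithZ {n} t)
palindromeWithZ? t x = palindrome? x ×-dec (Z x ℤ.≟ t)

#palindromes : ℕ → ℤ → ℕ
#palindromes j t = count (palindromeWithZ? t) (allWords (2* j +1))

count-mismatched-ends : ∀ n t a b → a ≢ b → countWithEnds n (palindromeWithZ? t) a b ≡ 0
count-mismatched-ends n t a b a≢b =
  count-none _ (λ y → a≢b ∘ proj₁ ∘ palindrome-ends a y b ∘ proj₁) (allWords n)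

count-matched-ends : ∀ j t a →
  countWithEnds (2* j +1) (palindromeWithZ? t) a a ≡ #palindromes j (zeroInd a ℤ.+ zeroInd a ℤ.- t)
count-matched-ends j t a = count-≐ _ (palindromeWithZ? (c ℤ.- t)) (peel , extend) (allWords (2* j +1))
  where
    c : ℤ
    c = zeroInd a ℤ.+ zeroInd a
    swap : ∀ {u v} → c ℤ.- u ≡ v → c ℤ.- v ≡ u
    swap {u} refl = c-[c-u]≡u c u
      where
        c-[c-u]≡u : ∀ c u → c ℤ.- (c ℤ.- u) ≡ u
        c-[c-u]≡u = solve-∀
    peel : ∀ {y} → PalindromeWithZ t (a ∷ (y ∷ʳ a)) → PalindromeWithZ (c ℤ.- t) y
    peel {y} (pal , Z≡t) =
      proj₂ (palindrome-ends a y a pal) , sym (swap (trans (sym (Z-∷-∷ʳ j a y)) Z≡t))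
    extend : ∀ {y} → PalindromeWithZ (c ℤ.- t) y → PalindromeWithZ t (a ∷ (y ∷ʳ a))
    extend {y} (pal , Z≡c-t) = palindrome-extend a y pal , trans (Z-∷-∷ʳ j a y) (swap (sym Z≡c-t))

#palindromes-suc : ∀ j t → #palindromes (suc j) t ≡ #palindromes j (+ 2 ℤ.- t) + #palindromes j (- t)
#palindromes-suc j t = begin
  #palindromes (suc j) t
    ≡⟨ count-allWords-ends m (palindromeWithZ? t) ⟩
  (ends false false + ends false true) + (ends true false + ends true true)
    ≡⟨ cong₂ _+_ (cong₂ _+_ (count-matched-ends j t false) (count-mismatched-ends m t false true (λ ())))
                  (cong₂ _+_ (count-mismatched-ends m t true false (λ ())) (count-matched-ends j t true)) ⟩
  (#palindromes j (+ 2 ℤ.- t) + 0) + (0 + #palindromes j (+ 0 ℤ.- t))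
    ≡⟨ cong₂ _+_ (ℕₚ.+-identityʳ _) (cong (#palindromes j) (ℤₚ.+-identityˡ (- t))) ⟩
  #palindromes j (+ 2 ℤ.- t) + #palindromes j (- t) ∎
  where
    open ≡-Reasoning
    m = 2* j +1
    ends = countWithEnds m (palindromeWithZ? t)

infixl 6.5 _Cℤ_

_Cℤ_ : ℕ → ℤ → ℕ
n Cℤ (+ k)    = n C k
n Cℤ -[1+ _ ] = 0

Cℤ-neg : ∀ n {m} → 0 < m → n Cℤ (- + m) ≡ 0
Cℤ-neg n {suc _} _ = refl

Cℤ-sym : ∀ n s → n Cℤ s ≡ n Cℤ (+ n ℤ.- s)
Cℤ-sym n (+ k) with k ≤? n
... | yes k≤n = trans (nCk≡nC[n∸k] k≤n) (cong (n Cℤ_) (sym n-k≡n∸k))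
  where n-k≡n∸k = trans (ℤₚ.m-n≡m⊖n n k) (ℤₚ.⊖-≥ k≤n)
... | no k≰n =
  trans (k>n⇒nCk≡0 n<k) (sym (trans (cong (n Cℤ_) n-k≡-[k∸n]) (Cℤ-neg n (ℕₚ.m<n⇒0<n∸m n<k))))
  where
    n<k = ℕₚ.≰⇒> k≰n
    n-k≡-[k∸n] = trans (ℤₚ.m-n≡m⊖n n k) (ℤₚ.⊖-< n<k)
Cℤ-sym n -[1+ k ] = sym (k>n⇒nCk≡0 (ℕₚ.m<m+n n (s≤s z≤n)))

Cℤ-pascal : ∀ n s → n Cℤ (s ℤ.+ 1ℤ) + n Cℤ s ≡ suc n Cℤ (s ℤ.+ 1ℤ)
Cℤ-pascal n (+ k) rewrite ℕₚ.+-comm k 1 =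
  trans (ℕₚ.+-comm (n C suc k) (n C k)) (nCk+nC[k+1]≡[n+1]C[k+1] n k)
Cℤ-pascal n -[1+ zero ]  = refl
Cℤ-pascal n -[1+ suc _ ] = refl

1+n-⌈n/2⌉≡⌈1+n/2⌉ : ∀ n → + suc n ℤ.- + ⌈ n /2⌉ ≡ + ⌈ suc n /2⌉
1+n-⌈n/2⌉≡⌈1+n/2⌉ n = begin
  + suc n ℤ.- + ⌈ n /2⌉
    ≡⟨ cong (λ m → + suc m ℤ.- + ⌈ n /2⌉) (ℕₚ.⌊n/2⌋+⌈n/2⌉≡n n) ⟨
  + (⌈ suc n /2⌉ + ⌈ n /2⌉) ℤ.- + ⌈ n /2⌉
    ≡⟨ cong (λ z → z ℤ.- + ⌈ n /2⌉) (ℤₚ.pos-+ ⌈ suc n /2⌉ ⌈ n /2⌉) ⟩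
  + ⌈ suc n /2⌉ ℤ.+ + ⌈ n /2⌉ ℤ.- + ⌈ n /2⌉
    ≡⟨ u+v-v≡u (+ ⌈ suc n /2⌉) (+ ⌈ n /2⌉) ⟩
  + ⌈ suc n /2⌉ ∎
  where
    open ≡-Reasoning
    u+v-v≡u : ∀ u v → u ℤ.+ v ℤ.- v ≡ u
    u+v-v≡u = solve-∀

#palindromes-odd : ∀ j u → #palindromes j (1ℤ ℤ.+ (u ℤ.+ u)) ≡ j Cℤ (+ ⌈ j /2⌉ ℤ.+ u)
#palindromes-odd zero (+ zero)    = refl
#palindromes-odd zero (+ suc _)   = refl
#palindromes-odd zero -[1+ _ ]    = refl
#palindromes-odd (suc j) u = begin
  #palindromes (suc j) (1ℤ ℤ.+ (u ℤ.+ u))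
    ≡⟨ #palindromes-suc j (1ℤ ℤ.+ (u ℤ.+ u)) ⟩
  #palindromes j (+ 2 ℤ.- (1ℤ ℤ.+ (u ℤ.+ u))) + #palindromes j (- (1ℤ ℤ.+ (u ℤ.+ u)))
    ≡⟨ cong₂ (λ v w → #palindromes j v + #palindromes j w) (reflect u) (reflect-shift u) ⟩
  #palindromes j (1ℤ ℤ.+ (- u ℤ.+ - u)) + #palindromes j (1ℤ ℤ.+ ((- u ℤ.- 1ℤ) ℤ.+ (- u ℤ.- 1ℤ)))
    ≡⟨ cong₂ _+_ (#palindromes-odd j (- u)) (#palindromes-odd j (- u ℤ.- 1ℤ)) ⟩
  j Cℤ (c ℤ.+ - u) + j Cℤ s
    ≡⟨ cong (λ v → j Cℤ v + j Cℤ s) (shift c u) ⟩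
  j Cℤ (s ℤ.+ 1ℤ) + j Cℤ s
    ≡⟨ Cℤ-pascal j s ⟩
  suc j Cℤ (s ℤ.+ 1ℤ)
    ≡⟨ Cℤ-sym (suc j) (s ℤ.+ 1ℤ) ⟩
  suc j Cℤ (+ suc j ℤ.- (s ℤ.+ 1ℤ))
    ≡⟨ cong (suc j Cℤ_) (complement (+ suc j) c u) ⟩
  suc j Cℤ (+ suc j ℤ.- c ℤ.+ u)
    ≡⟨ cong (λ v → suc j Cℤ (v ℤ.+ u)) (1+n-⌈n/2⌉≡⌈1+n/2⌉ j) ⟩
  suc j Cℤ (+ ⌈ suc j /2⌉ ℤ.+ u) ∎
  where
    open ≡-Reasoning
    c s : ℤ
    c = + ⌈ j /2⌉
    s = c ℤ.+ (- u ℤ.- 1ℤ)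
    reflect : ∀ u → + 2 ℤ.- (1ℤ ℤ.+ (u ℤ.+ u)) ≡ 1ℤ ℤ.+ (- u ℤ.+ - u)
    reflect = solve-∀
    reflect-shift : ∀ u → - (1ℤ ℤ.+ (u ℤ.+ u)) ≡ 1ℤ ℤ.+ ((- u ℤ.- 1ℤ) ℤ.+ (- u ℤ.- 1ℤ))
    reflect-shift = solve-∀
    shift : ∀ c u → c ℤ.+ - u ≡ c ℤ.+ (- u ℤ.- 1ℤ) ℤ.+ 1ℤ
    shift = solve-∀
    complement : ∀ n c u → n ℤ.- (c ℤ.+ (- u ℤ.- 1ℤ) ℤ.+ 1ℤ) ≡ n ℤ.- c ℤ.+ u
    complement = solve-∀

#palindromes-±1 : ∀ j → #palindromes j 1ℤ + #palindromes j -1ℤ ≡ suc j C ⌈ j /2⌉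
#palindromes-±1 j = begin
  #palindromes j 1ℤ + #palindromes j -1ℤ
    ≡⟨ cong₂ _+_ (#palindromes-odd j (+ 0)) (#palindromes-odd j -1ℤ) ⟩
  j Cℤ (c ℤ.+ + 0) + j Cℤ (c ℤ.+ -1ℤ)
    ≡⟨ cong (λ v → j Cℤ v + j Cℤ (c ℤ.+ -1ℤ)) (shift c) ⟩
  j Cℤ (c ℤ.+ -1ℤ ℤ.+ 1ℤ) + j Cℤ (c ℤ.+ -1ℤ)
    ≡⟨ Cℤ-pascal j (c ℤ.+ -1ℤ) ⟩
  suc j Cℤ (c ℤ.+ -1ℤ ℤ.+ 1ℤ)
    ≡⟨ cong (suc j Cℤ_) (shift c) ⟨
  suc j Cℤ (c ℤ.+ + 0)
    ≡⟨ cong (suc j Cℤ_) (ℤₚ.+-identityʳ c) ⟩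
  suc j C ⌈ j /2⌉ ∎
  where
    open ≡-Reasoning
    c : ℤ
    c = + ⌈ j /2⌉
    shift : ∀ c → c ℤ.+ + 0 ≡ c ℤ.+ -1ℤ ℤ.+ 1ℤ
    shift = solve-∀

palindromeInB1≐ : (λ (x : Vec Bool n) → IsPalindrome x × InB1 x) ≐
                  (PalindromeWithZ 1ℤ ∪ PalindromeWithZ -1ℤ)
palindromeInB1≐ = (λ { (p , inj₁ e) → inj₁ (p , e) ; (p , inj₂ e) → inj₂ (p , e) })
                , (λ { (inj₁ (p , e)) → p , inj₁ e ; (inj₂ (p , e)) → p , inj₂ e })

count-palindromesInB1 : ∀ j {m} → m ≡ 2* j +1 →
  (dec : Decidable (λ (x : Vec Bool m) → IsPalindrome x × InB1 x)) →
  count dec (allWords m) ≡ suc j C ⌈ j /2⌉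
count-palindromesInB1 j refl dec = begin
  count dec words
    ≡⟨ count-≐ dec (palindromeWithZ? 1ℤ ∪? palindromeWithZ? -1ℤ) palindromeInB1≐ words ⟩
  count (palindromeWithZ? 1ℤ ∪? palindromeWithZ? -1ℤ) words
    ≡⟨ count-∪ (palindromeWithZ? 1ℤ) (palindromeWithZ? -1ℤ) disjoint words ⟩
  #palindromes j 1ℤ + #palindromes j -1ℤ
    ≡⟨ #palindromes-±1 j ⟩
  suc j C ⌈ j /2⌉ ∎
  where
    open ≡-Reasoning
    words = allWords (2* j +1)
    disjoint : ∀ x → PalindromeWithZ 1ℤ x → ¬ PalindromeWithZ -1ℤ x
    disjoint _ (_ , Z≡1) (_ , Z≡-1) with trans (sym Z≡1) Z≡-1
    ... | ()

n/2≡⌊n/2⌋ : ∀ n → n / 2 ≡ ⌊ n /2⌋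
n/2≡⌊n/2⌋ zero          = refl
n/2≡⌊n/2⌋ (suc zero)    = refl
n/2≡⌊n/2⌋ (suc (suc n)) =
  trans (m/n≡1+[m∸n]/n {suc (suc n)} {2} (s≤s (s≤s z≤n))) (cong suc (n/2≡⌊n/2⌋ n))

2*n+1≡2*_+1 : ∀ n → 2 * n + 1 ≡ 2* n +1
2*n+1≡2*_+1 zero    = refl
2*n+1≡2*_+1 (suc n) = trans (unfold n) (cong (suc ∘ suc) (2*n+1≡2*_+1 n))
  where
    unfold : ∀ n → 2 * suc n + 1 ≡ suc (suc (2 * n + 1))
    unfold = ℕSolver.solve-∀

[2n+2]/2≡1+n : ∀ n → (2 * n + 1 + 1) / 2 ≡ suc n
[2n+2]/2≡1+n n = trans (cong (_/ 2) (2n+2≡[1+n]*2 n)) (m*n/n≡m (suc n) 2)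
  where
    2n+2≡[1+n]*2 : ∀ n → 2 * n + 1 + 1 ≡ suc n * 2
    2n+2≡[1+n]*2 = ℕSolver.solve-∀

[2n+2]/4≡⌈n/2⌉ : ∀ n → (2 * n + 1 + 1) / 4 ≡ ⌈ n /2⌉
[2n+2]/4≡⌈n/2⌉ n = begin
  (2 * n + 1 + 1) / 4     ≡⟨ cong (_/ 4) (2n+2≡2*[1+n] n) ⟩
  2 * suc n / (2 * 2)     ≡⟨ m*n/m*o≡n/o 2 (suc n) 2 ⟩
  suc n / 2               ≡⟨ n/2≡⌊n/2⌋ (suc n) ⟩
  ⌈ n /2⌉                 ∎
  where
    open ≡-Reasoning
    2n+2≡2*[1+n] : ∀ n → 2 * n + 1 + 1 ≡ 2 * suc n
    2n+2≡2*[1+n] = ℕSolver.solve-∀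

lemma3 : (k : ℕ) → k ≥ 1 →
    (dec : Decidable (λ (x : Vec Bool (2 * k + 1)) → IsPalindrome x × InB1 x)) →
    length (filter dec (allWords (2 * k + 1)))
      ≡ ((2 * k + 1 + 1) / 2) C ((2 * k + 1 + 1) / 4)
lemma3 k _ dec = begin
  count dec (allWords (2 * k + 1))                 ≡⟨ count-palindromesInB1 k (2*n+1≡2*_+1 k) dec ⟩
  suc k C ⌈ k /2⌉                                  ≡⟨ cong₂ _C_ ([2n+2]/2≡1+n k) ([2n+2]/4≡⌈n/2⌉ k) ⟨
  ((2 * k + 1 + 1) / 2) C ((2 * k + 1 + 1) / 4)    ∎
  where open ≡-Reasoning
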